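{- For integers $n\ge 2r\ge 2$, $\chi(H_{n:r})\le n-2r+2$.
   Context: For positive integers $n,r$ write $[n]=\{1,\dots,n\}$. The Häggkvist–Hell graph $H_{n:r}$ is the graph whose vertices are the ordered pairs $(h,T)$ where $T$ is an $r$-element subset of $[n]$ and $h\in[n]\setminus T$; two vertices $(h_x,T_x)$ and $(h_y,T_y)$ are adjacent iff $h_x\in T_y$, $h_y\in T_x$ and $T_x\cap T_y=\varnothing$. $\chi$ denotes chromatic number. -}

module Defs where

open import Data.Nat using (ℕ)
open import Data.Fin using (Fin)
open import Data.Fin.Subset using (Subset; _∈_; _∉_; _∩_; ∣_∣; ⊥)
open import Data.Product using (_×_; ∃)
open import Relation.Binary.PropositionalEquality using (_≡_; _≢_)

record HVertex (n r : ℕ) : Set where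
  constructor hv
  field
    h    : Fin n
    T    : Subset n
    card : ∣ T ∣ ≡ r
    h∉T  : h ∉ T

open HVertex public

HAdj : {n r : ℕ} → HVertex n r → HVertex n r → Set
HAdj x y = (h x ∈ T y) × (h y ∈ T x) × (T x ∩ T y ≡ ⊥)

ProperColouring : (n r k : ℕ) → (HVertex n r → Fin k) → Set
ProperColouring n r k c = ∀ x y → HAdj x y → c x ≢ c y

χ≤ : (n r k : ℕ) → Set
χ≤ n r k = ∃ λ (c : HVertex n r → Fin k) → ProperColouring n r k c

module Submission where

-- The colouring only looks at the set part T of a vertex (h , T): adjacent
-- vertices have disjoint sets, so it suffices to colour r-subsets of [n] so
-- that disjoint ones get different colours (the classical colouring of the
-- Kneser graph).  With k = n - 2r + 1, give T the colour min(first T, k),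
-- where first T is the least element of T.
--   * Two disjoint sets cannot share a least element, so equal colours
--     below k are impossible (disjoint-sets-have-distinct-minima).
--   * A set of colour k lies inside {k, …, n-1}, which has n - k = 2r - 1
--     elements; two disjoint r-sets do not fit there (disjoint-sets-above).

open import Defs
open import Data.Nat using (ℕ; _≤_; _*_; _+_; _∸_)
open import Data.Nat using (zero; suc; _<_; _⊓_; _<?_; z≤n; s≤s)
open import Data.Nat.Properties
open import Data.Bool using (true; false)
open import Data.Vec using ([]; _∷_; tail)
open import Data.Fin using (Fin; fromℕ<)
open import Data.Fin.Properties using (fromℕ<-injective)
open import Data.Fin.Subset using (Subset; _∩_; ∣_∣; ⊥)
open import Data.Product using (_×_; _,_)
open import Data.Sum using (_⊎_; inj₁; inj₂)
open import Data.Empty using () renaming (⊥ to Empty; ⊥-elim to contradiction)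
open import Relation.Nullary using (yes; no)
open import Relation.Binary.PropositionalEquality

Disjoint : ∀ {m} → Subset m → Subset m → Set
Disjoint p q = p ∩ q ≡ ⊥

disjoint-tail : ∀ {m} a b (p q : Subset m) →
                Disjoint (a ∷ p) (b ∷ q) → Disjoint p q
disjoint-tail _ _ _ _ = cong tail

-- Index of the least element of p; equals m exactly when p is empty.
first : ∀ {m} → Subset m → ℕ
first []          = 0
first (true ∷ p)  = 0
first (false ∷ p) = suc (first p)

disjoint-sets-have-distinct-minima :
  ∀ {m} (p q : Subset m) → Disjoint p q → first p ≡ first q → first p < m → Empty
disjoint-sets-have-distinct-minima (true ∷ p)  (true ∷ q)  ()
disjoint-sets-have-distinct-minima (false ∷ p) (false ∷ q) pq-disj eq (s≤s lt) =
  disjoint-sets-have-distinct-minima p q (disjoint-tail false false p q pq-disj)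
    (suc-injective eq) lt

disjoint-size : ∀ {m} (p q : Subset m) → Disjoint p q → ∣ p ∣ + ∣ q ∣ ≤ m
disjoint-size []          []          _       = z≤n
disjoint-size (true ∷ p)  (true ∷ q)  ()
disjoint-size (true ∷ p)  (false ∷ q) pq-disj =
  s≤s (disjoint-size p q (disjoint-tail true false p q pq-disj))
disjoint-size (false ∷ p) (true ∷ q)  pq-disj =
  ≤-trans (≤-reflexive (+-suc ∣ p ∣ ∣ q ∣))
          (s≤s (disjoint-size p q (disjoint-tail false true p q pq-disj)))
disjoint-size (false ∷ p) (false ∷ q) pq-disj =
  m≤n⇒m≤1+n (disjoint-size p q (disjoint-tail false false p q pq-disj))

disjoint-sets-above : ∀ {m} (p q : Subset m) j → Disjoint p q →
                      j ≤ first p → j ≤ first q → j + (∣ p ∣ + ∣ q ∣) ≤ m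
disjoint-sets-above p q zero pq-disj _ _ = disjoint-size p q pq-disj
disjoint-sets-above (false ∷ p) (false ∷ q) (suc j) pq-disj (s≤s j≤p) (s≤s j≤q) =
  s≤s (disjoint-sets-above p q j (disjoint-tail false false p q pq-disj) j≤p j≤q)

-- Truncations a ⊓ k and b ⊓ k agree only if a = b < k or both a, b ≥ k;
-- a mixed case a < k ≤ b would give a = a ⊓ k = b ⊓ k = k.
⊓-collision : ∀ a b k → a ⊓ k ≡ b ⊓ k → (a ≡ b × a < k) ⊎ (k ≤ a × k ≤ b)
⊓-collision a b k eq with a <? k | b <? k
... | yes a<k | yes b<k = inj₁ (a≡b , a<k)
  where
  a≡b : a ≡ b
  a≡b = begin
    a     ≡⟨ m≤n⇒m⊓n≡m (<⇒≤ a<k) ⟨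
    a ⊓ k ≡⟨ eq ⟩
    b ⊓ k ≡⟨ m≤n⇒m⊓n≡m (<⇒≤ b<k) ⟩
    b     ∎
    where open ≡-Reasoning
... | yes a<k | no  b≮k =
  contradiction (<-irrefl (trans (sym (m≤n⇒m⊓n≡m (<⇒≤ a<k)))
                                 (trans eq (m≥n⇒m⊓n≡n (≮⇒≥ b≮k)))) a<k)
... | no  a≮k | yes b<k =
  contradiction (<-irrefl (trans (sym (m≤n⇒m⊓n≡m (<⇒≤ b<k)))
                                 (trans (sym eq) (m≥n⇒m⊓n≡n (≮⇒≥ a≮k)))) b<k)
... | no  a≮k | no  b≮k = inj₂ (≮⇒≥ a≮k , ≮⇒≥ b≮k)

-- The truncation threshold k = n - 2r + 1 is a position of [n] when r ≥ 1 …
threshold≤n : ∀ n r → 1 ≤ r → 2 * r ≤ n → suc (n ∸ 2 * r) ≤ n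
threshold≤n n r 1≤r 2r≤n = begin
  suc (n ∸ 2 * r)   ≡⟨ +-comm 1 (n ∸ 2 * r) ⟩
  n ∸ 2 * r + 1     ≤⟨ +-monoʳ-≤ (n ∸ 2 * r) (≤-trans 1≤r (m≤n*m r 2)) ⟩
  n ∸ 2 * r + 2 * r ≡⟨ m∸n+n≡m 2r≤n ⟩
  n                 ∎
  where open ≤-Reasoning

-- … and two r-sets do not fit beyond it.
threshold-overflow : ∀ n r → 2 * r ≤ n → suc (n ∸ 2 * r) + (r + r) ≤ n → Empty
threshold-overflow n r 2r≤n fits = 1+n≰n (begin
  suc n                       ≡⟨ cong suc (m∸n+n≡m 2r≤n) ⟨
  suc (n ∸ 2 * r + 2 * r)     ≡⟨ cong (λ s → suc (n ∸ 2 * r + (r + s))) (+-identityʳ r) ⟩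
  suc (n ∸ 2 * r) + (r + r)   ≤⟨ fits ⟩
  n                           ∎)
  where open ≤-Reasoning

kneserColour : ∀ n r → Subset n → Fin (n ∸ 2 * r + 2)
kneserColour n r p = fromℕ< (begin-strict
  first p ⊓ suc (n ∸ 2 * r) ≤⟨ m⊓n≤n (first p) _ ⟩
  suc (n ∸ 2 * r)           <⟨ ≤-refl ⟩
  suc (suc (n ∸ 2 * r))     ≡⟨ +-comm 2 (n ∸ 2 * r) ⟩
  n ∸ 2 * r + 2             ∎)
  where open ≤-Reasoning

kneserColour-proper : ∀ n r → 1 ≤ r → 2 * r ≤ n → (p q : Subset n) →
                      ∣ p ∣ ≡ r → ∣ q ∣ ≡ r → Disjoint p q →
                      kneserColour n r p ≢ kneserColour n r q
kneserColour-proper n r 1≤r 2r≤n p q ∣p∣≡r ∣q∣≡r pq-disj same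
  with ⊓-collision (first p) (first q) k (fromℕ<-injective _ _ _ _ same)
  where k = suc (n ∸ 2 * r)
... | inj₁ (first≡ , first<k) =
  disjoint-sets-have-distinct-minima p q pq-disj first≡
    (≤-trans first<k (threshold≤n n r 1≤r 2r≤n))
... | inj₂ (k≤p , k≤q) =
  threshold-overflow n r 2r≤n
    (subst (λ s → suc (n ∸ 2 * r) + s ≤ n) (cong₂ _+_ ∣p∣≡r ∣q∣≡r)
      (disjoint-sets-above p q _ pq-disj k≤p k≤q))

mainTheorem5 : (n r : ℕ) → 1 ≤ r → 2 * r ≤ n → χ≤ n r (n ∸ 2 * r + 2)
mainTheorem5 n r 1≤r 2r≤n = colour , proper
  where
  colour : HVertex n r → Fin (n ∸ 2 * r + 2)
  colour x = kneserColour n r (T x)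

  proper : ProperColouring n r (n ∸ 2 * r + 2) colour
  proper x y (_ , _ , sets-disjoint) =
    kneserColour-proper n r 1≤r 2r≤n (T x) (T y) (card x) (card y) sets-disjoint
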